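{- For every integer $k \geq 2$ and every finite structure $\mathcal{M}$ with $\mathrm{spt}(\mathcal{M}) \leq k$ we have $\mathrm{spt}^*(\mathcal{M}) \leq k^{k+2}$.
   Context: Structures are for a fixed finite relational vocabulary (with universe $[n]$ for some $n$). For a finite structure $\mathcal{M}$: $\mathrm{spt}(\mathcal{M})=\max\{|\{a\in M:f(a)\neq a\}| : f\in\mathrm{Aut}(\mathcal{M})\}$, and $\mathrm{spt}^*(\mathcal{M})=|\{a\in M: f(a)\neq a \text{ for some } f\in\mathrm{Aut}(\mathcal{M})\}|$. -}

module Defs where

open import Data.Nat using (ℕ; _≤_)
open import Data.Bool using (Bool; not)
open import Data.List using (List; length; lookup)
open import Data.Fin using (Fin; _≟_)
open import Data.Fin.Subset using (Subset; ∣_∣; _∈_)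
open import Data.Fin.Permutation using (Permutation′; _⟨$⟩ʳ_)
open import Data.Vec using (tabulate)
open import Data.Product using (Σ; _×_)
open import Relation.Nullary using (¬_; ⌊_⌋)
open import Relation.Binary.PropositionalEquality using (_≡_)

Vocabulary : Set
Vocabulary = List ℕ

Symbol : Vocabulary → Set
Symbol L = Fin (length L)

arity : (L : Vocabulary) → Symbol L → ℕ
arity L R = lookup L R

Structure : Vocabulary → ℕ → Set
Structure L n = (R : Symbol L) → (Fin (arity L R) → Fin n) → Bool

IsAutomorphism : {L : Vocabulary} {n : ℕ} → Structure L n → Permutation′ n → Set
IsAutomorphism {L} {n} M f =
  (R : Symbol L) (as : Fin (arity L R) → Fin n) →
  M R (λ j → f ⟨$⟩ʳ as j) ≡ M R as

support : {n : ℕ} → Permutation′ n → Subset n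
support f = tabulate (λ a → not ⌊ f ⟨$⟩ʳ a ≟ a ⌋)

SptLe : (L : Vocabulary) {n : ℕ} → Structure L n → ℕ → Set
SptLe L {n} M k = (f : Permutation′ n) → IsAutomorphism {L} M f → ∣ support f ∣ ≤ k

Movable : {L : Vocabulary} {n : ℕ} → Structure L n → Fin n → Set
Movable {L} {n} M a = Σ (Permutation′ n) (λ f → IsAutomorphism {L} M f × ¬ (f ⟨$⟩ʳ a ≡ a))

-- spt*(M) ≤ b  :  the set of points moved by some automorphism has size ≤ b,
-- i.e. every set S consisting of movable points has |S| ≤ b.
SptStarLe : (L : Vocabulary) {n : ℕ} → Structure L n → ℕ → Set
SptStarLe L {n} M b = (S : Subset n) → (∀ a → a ∈ S → Movable {L} M a) → ∣ S ∣ ≤ b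

-- Choose for every a ∈ S an automorphism g_a moving a, and let G be a finite set of automorphisms
-- containing the identity and closed under h ↦ g_a ∘ h. For a ∈ S this map is injective and sends
-- the elements of G fixing a to elements moving a, so at least half of G moves a. Counting the pairs
-- (a, h) with a ∈ S, h ∈ G, h a ≠ a therefore gives |S| |G| / 2 ≤ k |G|, i.e. spt*(M) ≤ 2 spt(M),
-- and 2k ≤ k^(k+2).
module Submission where

open import Defs
open import Data.Nat using (ℕ; _≤_; _^_; _+_)
open import Data.Nat.Base using (zero; suc; _*_; _<_; z≤n; s≤s; >-nonZero)
open import Data.Nat.Properties hiding (_≟_)
open import Data.Nat.ListAction using (sum)
open import Data.Bool.Base using (Bool; true; false; T; _∧_; not)
open import Data.List.Base using (List; []; _∷_; _++_; [_]; length; map; concatMap; filter; allFin)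
open import Data.List.Properties using (length-++; length-map)
open import Data.List.Membership.Propositional using (_∈_; find)
open import Data.List.Membership.Propositional.Properties
  using (∈-map⁺; ∈-map⁻; ∈-concatMap⁺; ∈-allFin; ∈-++⁺ˡ; ∈-++⁺ʳ; ∈-++⁻; ∈-∃++; ∈-filter⁺; ∈-filter⁻; ∈-length)
open import Data.List.Relation.Binary.Subset.Propositional using (_⊆_)
open import Data.List.Relation.Unary.Any as Any using (here; there)
open import Data.List.Relation.Unary.All as All using (all?; [])
open import Data.List.Relation.Unary.All.Properties using (All¬⇒¬Any; ¬Any⇒All¬; ¬All⇒Any¬)
open import Data.List.Relation.Unary.Unique.Propositional using (Unique; []; _∷_)
import Data.List.Relation.Unary.Unique.Propositional.Properties as Unique
open import Data.Fin.Base as Fin using (Fin)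
open import Data.Fin.Properties using (_≟_)
open import Data.Fin.Subset using (Subset; ∣_∣) renaming (_∈_ to _∈ₛ_)
open import Data.Fin.Permutation as Perm using (Permutation′; _⟨$⟩ʳ_; _⟨$⟩ˡ_; _∘ₚ_)
open import Data.Vec.Base as Vec using (Vec; tabulate; lookup)
open import Data.Vec.Properties using (≡-dec; tabulate-∘; tabulate∘lookup; lookup∘tabulate; lookup-map; map-∘; map-cong; map-id; lookup⇒[]=)
open import Data.Product using (Σ; _×_; _,_; proj₁; proj₂)
open import Data.Sum using (inj₁; inj₂)
open import Function using (_∘_; id)
open import Level using (0ℓ)
open import Relation.Binary.Definitions using (DecidableEquality)
open import Relation.Binary.PropositionalEquality
  using (_≡_; _≢_; refl; sym; trans; cong; subst; module ≡-Reasoning)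
open import Relation.Nullary using (¬_; yes; no; does; ⌊_⌋; ¬?; _×-dec_; contradiction)
open import Relation.Nullary.Decidable using (T?; decidable-stable; isYes≗does)
open import Relation.Unary using (Pred; Decidable)
open import Relation.Unary.Properties using (∁?)
open import Algebra.Properties.Semiring.Sum +-*-semiring
  using (sum-syntax; sum-cong-≗; sum-replicate-zero; ∑-distrib-+; *-distribˡ-sum; *-distribʳ-sum)

𝟙 : Bool → ℕ
𝟙 true = 1
𝟙 false = 0

𝟙-∧-≤ʳ : ∀ x y → 𝟙 (x ∧ y) ≤ 𝟙 y
𝟙-∧-≤ʳ true y = ≤-refl
𝟙-∧-≤ʳ false y = z≤n

𝟙-*-≤ : ∀ b {m c} → (T b → m ≤ c) → 𝟙 b * m ≤ c
𝟙-*-≤ true {m} m≤c = ≤-trans (≤-reflexive (*-identityˡ m)) (m≤c _)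
𝟙-*-≤ false _ = z≤n

module _ {A : Set} where

  unique-⊆⇒length≤ : {xs ys : List A} → Unique xs → xs ⊆ ys → length xs ≤ length ys
  unique-⊆⇒length≤ [] _ = z≤n
  unique-⊆⇒length≤ {x ∷ xs} (x∉xs ∷ uniq) xs⊆ys
    with us , vs , refl ← ∈-∃++ (xs⊆ys (here refl)) = begin
      suc (length xs)             ≤⟨ s≤s (unique-⊆⇒length≤ uniq xs⊆us++vs) ⟩
      suc (length (us ++ vs))     ≡⟨ cong suc (length-++ us) ⟩
      suc (length us + length vs) ≡⟨ +-suc (length us) (length vs) ⟨
      length us + length (x ∷ vs) ≡⟨ length-++ us ⟨
      length (us ++ x ∷ vs)       ∎
    where
    open ≤-Reasoning
    xs⊆us++vs : xs ⊆ us ++ vs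
    xs⊆us++vs z∈xs with ∈-++⁻ us (xs⊆ys (there z∈xs))
    ... | inj₁ z∈us = ∈-++⁺ˡ z∈us
    ... | inj₂ (here refl) = contradiction z∈xs (All¬⇒¬Any x∉xs)
    ... | inj₂ (there z∈vs) = ∈-++⁺ʳ us z∈vs

  module _ {P : Pred A 0ℓ} (P? : Decidable P) where

    length-filter-∷ : ∀ x xs → length (filter P? (x ∷ xs)) ≡ 𝟙 (does (P? x)) + length (filter P? xs)
    length-filter-∷ x xs with does (P? x)
    ... | true = refl
    ... | false = refl

    length-filter+length-filter-∁ : ∀ xs → length (filter P? xs) + length (filter (∁? P?) xs) ≡ length xs
    length-filter+length-filter-∁ [] = refl
    length-filter+length-filter-∁ (x ∷ xs) with does (P? x)
    ... | true = cong suc (length-filter+length-filter-∁ xs)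
    ... | false = trans (+-suc _ _) (cong suc (length-filter+length-filter-∁ xs))

    length≤2*length-filter : ∀ {xs} (h : A → A) → (∀ {x y} → h x ≡ h y → x ≡ y) → Unique xs →
      (∀ {x} → x ∈ xs → ¬ P x → h x ∈ xs × P (h x)) → length xs ≤ 2 * length (filter P? xs)
    length≤2*length-filter {xs} h h-injective uniq h-into-P = begin
      length xs                                          ≡⟨ length-filter+length-filter-∁ xs ⟨
      length (filter P? xs) + length (filter (∁? P?) xs) ≤⟨ +-monoʳ-≤ (length (filter P? xs)) outside≤inside ⟩
      length (filter P? xs) + length (filter P? xs)      ≡⟨ cong (length (filter P? xs) +_) (+-identityʳ _) ⟨
      2 * length (filter P? xs)                          ∎
      where
      open ≤-Reasoning
      image⊆ : map h (filter (∁? P?) xs) ⊆ filter P? xs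
      image⊆ z∈ with x , x∈ , refl ← ∈-map⁻ h z∈ with x∈xs , ¬Px ← ∈-filter⁻ (∁? P?) x∈ =
        let hx∈xs , Phx = h-into-P x∈xs ¬Px in ∈-filter⁺ P? hx∈xs Phx
      outside≤inside : length (filter (∁? P?) xs) ≤ length (filter P? xs)
      outside≤inside = begin
        length (filter (∁? P?) xs)         ≡⟨ length-map h (filter (∁? P?) xs) ⟨
        length (map h (filter (∁? P?) xs)) ≤⟨ unique-⊆⇒length≤ (Unique.map⁺ h-injective (Unique.filter⁺ (∁? P?) uniq)) image⊆ ⟩
        length (filter P? xs)              ∎

  sum-map-≤ : (f : A → ℕ) {k : ℕ} (ys : List A) → (∀ {y} → y ∈ ys → f y ≤ k) → sum (map f ys) ≤ k * length ys
  sum-map-≤ f [] _ = z≤n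
  sum-map-≤ f {k} (y ∷ ys) f≤k = begin
    f y + sum (map f ys) ≤⟨ +-mono-≤ (f≤k (here refl)) (sum-map-≤ f ys (f≤k ∘ there)) ⟩
    k + k * length ys    ≡⟨ *-suc k (length ys) ⟨
    k * length (y ∷ ys)  ∎
    where open ≤-Reasoning

∑-mono-≤ : ∀ {m} {f g : Fin m → ℕ} → (∀ i → f i ≤ g i) → ∑[ i < m ] f i ≤ ∑[ i < m ] g i
∑-mono-≤ {zero} _ = z≤n
∑-mono-≤ {suc m} f≤g = +-mono-≤ (f≤g Fin.zero) (∑-mono-≤ (f≤g ∘ Fin.suc))

∣tabulate∣≡∑𝟙 : ∀ {n} (b : Fin n → Bool) → ∣ tabulate b ∣ ≡ ∑[ a < n ] 𝟙 (b a)
∣tabulate∣≡∑𝟙 {zero} b = refl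
∣tabulate∣≡∑𝟙 {suc n} b with b Fin.zero
... | true = cong suc (∣tabulate∣≡∑𝟙 (b ∘ Fin.suc))
... | false = ∣tabulate∣≡∑𝟙 (b ∘ Fin.suc)

double-counting : ∀ {A : Set} {n} {R : Fin n → Pred A 0ℓ} (R? : ∀ a → Decidable (R a)) (ys : List A) →
  ∑[ a < n ] length (filter (R? a) ys) ≡ sum (map (λ y → ∑[ a < n ] 𝟙 (does (R? a y))) ys)
double-counting {n = n} R? [] = sum-replicate-zero n
double-counting {n = n} R? (y ∷ ys) = begin
  ∑[ a < n ] length (filter (R? a) (y ∷ ys))
    ≡⟨ sum-cong-≗ (λ a → length-filter-∷ (R? a) y ys) ⟩
  ∑[ a < n ] (𝟙 (does (R? a y)) + length (filter (R? a) ys))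
    ≡⟨ ∑-distrib-+ (λ a → 𝟙 (does (R? a y))) (λ a → length (filter (R? a) ys)) ⟩
  ∑[ a < n ] 𝟙 (does (R? a y)) + ∑[ a < n ] length (filter (R? a) ys)
    ≡⟨ cong (∑[ a < n ] 𝟙 (does (R? a y)) +_) (double-counting R? ys) ⟩
  sum (map (λ y → ∑[ a < n ] 𝟙 (does (R? a y))) (y ∷ ys)) ∎
  where open ≡-Reasoning

vectors : {A : Set} → List A → (m : ℕ) → List (Vec A m)
vectors xs zero = [ Vec.[] ]
vectors xs (suc m) = concatMap (λ x → map (x Vec.∷_) (vectors xs m)) xs

∈-vectors : {A : Set} {xs : List A} → (∀ x → x ∈ xs) → ∀ {m} (v : Vec A m) → v ∈ vectors xs m
∈-vectors complete Vec.[] = here refl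
∈-vectors {xs = xs} complete {suc m} (x Vec.∷ v) =
  ∈-concatMap⁺ (λ x → map (x Vec.∷_) (vectors xs m))
    (Any.map (λ { refl → ∈-map⁺ (x Vec.∷_) (∈-vectors complete v) }) (complete x))

module Saturation {A : Set} (_≟ᴬ_ : DecidableEquality A)
                  {universe : List A} (complete : ∀ x → x ∈ universe)
                  (steps : List (A → A))
                  {P : A → Set} (P-step : ∀ {f x} → f ∈ steps → P x → P (f x)) where

  open import Data.List.Membership.DecPropositional _≟ᴬ_ using (_∈?_)

  Closed : List A → Set
  Closed ys = ∀ {f x} → f ∈ steps → x ∈ ys → f x ∈ ys

  record Closure (x₀ : A) : Set where
    field
      elements : List A
      seed : x₀ ∈ elements
      unique : Unique elements
      all-P : ∀ {x} → x ∈ elements → P x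
      closed : Closed elements

  -- Each round adds a new element, and the fuel exceeds the room left in the universe, so it never runs out.
  private
    grow : ∀ {x₀} fuel ys → x₀ ∈ ys → Unique ys → (∀ {x} → x ∈ ys → P x) →
           length universe < length ys + fuel → Closure x₀
    grow zero ys _ uniq _ overfull =
      contradiction (unique-⊆⇒length≤ uniq (λ {x} _ → complete x))
                    (<⇒≱ (subst (length universe <_) (+-identityʳ _) overfull))
    grow (suc fuel) ys x₀∈ys uniq P-ys room
      with all? (λ f → all? (λ x → f x ∈? ys) ys) steps
    ... | yes closed = record
      { elements = ys ; seed = x₀∈ys ; unique = uniq ; all-P = P-ys
      ; closed = λ f∈ x∈ → All.lookup (All.lookup closed f∈) x∈ }
    ... | no ¬closed
      with f , f∈steps , ¬closed-f ← find (¬All⇒Any¬ (λ f → all? (λ x → f x ∈? ys) ys) steps ¬closed)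
      with x , x∈ys , fx∉ys ← find (¬All⇒Any¬ (λ x → f x ∈? ys) ys ¬closed-f) =
      grow fuel (f x ∷ ys) (there x₀∈ys) (¬Any⇒All¬ ys fx∉ys ∷ uniq) P-fx∷ys
           (subst (length universe <_) (+-suc (length ys) fuel) room)
      where
      P-fx∷ys : ∀ {y} → y ∈ f x ∷ ys → P y
      P-fx∷ys (here refl) = P-step f∈steps (P-ys x∈ys)
      P-fx∷ys (there y∈ys) = P-ys y∈ys

  closure : ∀ x₀ → P x₀ → Closure x₀
  closure x₀ P-x₀ = grow (suc (length universe)) [ x₀ ] (here refl) ([] ∷ [])
                         (λ { (here refl) → P-x₀ }) (s≤s (n≤1+n _))

-- Automorphisms are collected through their value tables, which, unlike permutations, have decidable equality.
Table : ℕ → Set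
Table n = Vec (Fin n) n

table : ∀ {n} → Permutation′ n → Table n
table f = tabulate (f ⟨$⟩ʳ_)

translate : ∀ {n} → Permutation′ n → Table n → Table n
translate g = Vec.map (g ⟨$⟩ʳ_)

table-∘ₚ : ∀ {n} (f g : Permutation′ n) → table (f ∘ₚ g) ≡ translate g (table f)
table-∘ₚ f g = tabulate-∘ (g ⟨$⟩ʳ_) (f ⟨$⟩ʳ_)

translate-injective : ∀ {n} (g : Permutation′ n) {v w : Table n} → translate g v ≡ translate g w → v ≡ w
translate-injective g {v} {w} eq = begin
  v                                   ≡⟨ untranslate v ⟨
  Vec.map (g ⟨$⟩ˡ_) (translate g v)   ≡⟨ cong (Vec.map (g ⟨$⟩ˡ_)) eq ⟩
  Vec.map (g ⟨$⟩ˡ_) (translate g w)   ≡⟨ untranslate w ⟩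
  w                                   ∎
  where
  open ≡-Reasoning
  untranslate : ∀ u → Vec.map (g ⟨$⟩ˡ_) (translate g u) ≡ u
  untranslate u = begin
    Vec.map (g ⟨$⟩ˡ_) (Vec.map (g ⟨$⟩ʳ_) u) ≡⟨ map-∘ (g ⟨$⟩ˡ_) (g ⟨$⟩ʳ_) u ⟨
    Vec.map ((g ⟨$⟩ˡ_) ∘ (g ⟨$⟩ʳ_)) u     ≡⟨ map-cong (λ _ → Perm.inverseˡ g) u ⟩
    Vec.map id u                          ≡⟨ map-id u ⟩
    u                                     ∎

module _ {L : Vocabulary} {n : ℕ} (M : Structure L n) where

  AutomorphismTable : Table n → Set
  AutomorphismTable v = Σ (Permutation′ n) λ f → IsAutomorphism {L} M f × table f ≡ v

  id-isAutomorphism : IsAutomorphism {L} M Perm.id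
  id-isAutomorphism _ _ = refl

  ∘ₚ-isAutomorphism : ∀ {f g} → IsAutomorphism {L} M f → IsAutomorphism {L} M g → IsAutomorphism {L} M (f ∘ₚ g)
  ∘ₚ-isAutomorphism f-aut g-aut R as = trans (g-aut R _) (f-aut R as)

module MovablePoints {L : Vocabulary} {n : ℕ} (M : Structure L n)
                     (S : Subset n) (movable : ∀ a → a ∈ₛ S → Movable {L} M a) where

  moverFor : ∀ a → Σ (Permutation′ n) λ g → IsAutomorphism {L} M g × (T (lookup S a) → g ⟨$⟩ʳ a ≢ a)
  moverFor a with lookup S a in a∈S
  ... | true = let g , g-aut , g-moves = movable a (lookup⇒[]= a S a∈S) in g , g-aut , λ _ → g-moves
  ... | false = Perm.id , id-isAutomorphism {L} M , λ ()

  mover : Fin n → Permutation′ n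
  mover a = proj₁ (moverFor a)

  mover-isAutomorphism : ∀ a → IsAutomorphism {L} M (mover a)
  mover-isAutomorphism a = proj₁ (proj₂ (moverFor a))

  mover-moves : ∀ a → T (lookup S a) → mover a ⟨$⟩ʳ a ≢ a
  mover-moves a = proj₂ (proj₂ (moverFor a))

  steps : List (Table n → Table n)
  steps = map (translate ∘ mover) (allFin n)

  step-preserves : ∀ {f v} → f ∈ steps → AutomorphismTable {L} M v → AutomorphismTable {L} M (f v)
  step-preserves f∈steps (g , g-aut , refl) with a , _ , refl ← ∈-map⁻ (translate ∘ mover) f∈steps =
    g ∘ₚ mover a , ∘ₚ-isAutomorphism {L} M {g} {mover a} g-aut (mover-isAutomorphism a) , table-∘ₚ g (mover a)

  open Saturation (≡-dec _≟_) (∈-vectors ∈-allFin) steps {AutomorphismTable {L} M} step-preserves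

  -- A finite stand-in for the group generated by the movers; only closure under each mover is needed.
  orbit : Closure (table Perm.id)
  orbit = closure (table Perm.id) (Perm.id , id-isAutomorphism {L} M , refl)

  open Closure orbit

  MovedIn : Fin n → Pred (Table n) 0ℓ
  MovedIn a v = T (lookup S a) × lookup v a ≢ a

  movedIn? : ∀ a → Decidable (MovedIn a)
  movedIn? a v = T? (lookup S a) ×-dec ¬? (lookup v a ≟ a)

  orbit-half-moves : ∀ a → T (lookup S a) → length elements ≤ 2 * length (filter (movedIn? a) elements)
  orbit-half-moves a a∈S =
    length≤2*length-filter (movedIn? a) (translate (mover a)) (translate-injective (mover a)) unique fixers-to-movers
    where
    fixers-to-movers : ∀ {v} → v ∈ elements → ¬ MovedIn a v →
                       translate (mover a) v ∈ elements × MovedIn a (translate (mover a) v)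
    fixers-to-movers {v} v∈ not-moved = closed (∈-map⁺ (translate ∘ mover) (∈-allFin a)) v∈ , a∈S , moved
      where
      fixed : lookup v a ≡ a
      fixed = decidable-stable (lookup v a ≟ a) (λ v-moves-a → not-moved (a∈S , v-moves-a))
      moved : lookup (translate (mover a) v) a ≢ a
      moved eq = mover-moves a a∈S (begin
        mover a ⟨$⟩ʳ a                    ≡⟨ cong (mover a ⟨$⟩ʳ_) fixed ⟨
        mover a ⟨$⟩ʳ lookup v a           ≡⟨ lookup-map a (mover a ⟨$⟩ʳ_) v ⟨
        lookup (translate (mover a) v) a  ≡⟨ eq ⟩
        a                                 ∎)
        where open ≡-Reasoning

  orbit-moved-by-each≤k : ∀ {k} → SptLe L M k → ∀ {v} → v ∈ elements → ∑[ a < n ] 𝟙 (does (movedIn? a v)) ≤ k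
  orbit-moved-by-each≤k {k} spt v∈ with f , f-aut , refl ← all-P v∈ = begin
    ∑[ a < n ] 𝟙 (does (movedIn? a (table f)))        ≤⟨ ∑-mono-≤ (λ a → 𝟙-∧-≤ʳ (lookup S a) _) ⟩
    ∑[ a < n ] 𝟙 (not (does (lookup (table f) a ≟ a))) ≡⟨ sum-cong-≗ (cong (𝟙 ∘ not) ∘ table-fixes) ⟩
    ∑[ a < n ] 𝟙 (not ⌊ f ⟨$⟩ʳ a ≟ a ⌋)                ≡⟨ ∣tabulate∣≡∑𝟙 (λ a → not ⌊ f ⟨$⟩ʳ a ≟ a ⌋) ⟨
    ∣ support f ∣                                      ≤⟨ spt f f-aut ⟩
    k                                                  ∎
    where
    open ≤-Reasoning
    table-fixes : ∀ a → does (lookup (table f) a ≟ a) ≡ ⌊ f ⟨$⟩ʳ a ≟ a ⌋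
    table-fixes a = trans (cong (λ b → does (b ≟ a)) (lookup∘tabulate (f ⟨$⟩ʳ_) a)) (sym (isYes≗does _))

  ∣S∣≤2*k : ∀ {k} → SptLe L M k → ∣ S ∣ ≤ 2 * k
  ∣S∣≤2*k {k} spt = *-cancelʳ-≤ ∣ S ∣ (2 * k) m {{>-nonZero (∈-length seed)}} (begin
    ∣ S ∣ * m                                            ≡⟨ cong (λ p → ∣ p ∣ * m) (tabulate∘lookup S) ⟨
    ∣ tabulate (lookup S) ∣ * m                          ≡⟨ cong (_* m) (∣tabulate∣≡∑𝟙 (lookup S)) ⟩
    (∑[ a < n ] 𝟙 (lookup S a)) * m                      ≡⟨ *-distribʳ-sum m (𝟙 ∘ lookup S) ⟩
    ∑[ a < n ] (𝟙 (lookup S a) * m)                      ≤⟨ ∑-mono-≤ (λ a → 𝟙-*-≤ (lookup S a) (orbit-half-moves a)) ⟩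
    ∑[ a < n ] (2 * length (filter (movedIn? a) elements)) ≡⟨ *-distribˡ-sum 2 (λ a → length (filter (movedIn? a) elements)) ⟨
    2 * ∑[ a < n ] length (filter (movedIn? a) elements) ≡⟨ cong (2 *_) (double-counting movedIn? elements) ⟩
    2 * sum (map (λ v → ∑[ a < n ] 𝟙 (does (movedIn? a v))) elements)
                                                         ≤⟨ *-monoʳ-≤ 2 (sum-map-≤ _ elements (orbit-moved-by-each≤k spt)) ⟩
    2 * (k * m)                                          ≡⟨ *-assoc 2 k m ⟨
    2 * k * m                                            ∎)
    where
    m = length elements
    open ≤-Reasoning

spt*≤2*spt : ∀ {L n} (M : Structure L n) {k} → SptLe L M k → SptStarLe L M (2 * k)
spt*≤2*spt {L} M spt S movable = MovablePoints.∣S∣≤2*k {L} M S movable spt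

2*k≤k^[k+2] : ∀ k → 2 ≤ k → 2 * k ≤ k ^ (k + 2)
2*k≤k^[k+2] k@(suc (suc _)) _ = begin
  2 * k           ≤⟨ *-monoˡ-≤ k {2} {k} (s≤s (s≤s z≤n)) ⟩
  k * k           ≤⟨ *-monoʳ-≤ k (m≤m*n k (k ^ k) {{m^n≢0 k k}}) ⟩
  k * (k * k ^ k) ≡⟨ cong (k ^_) (+-comm 2 k) ⟩
  k ^ (k + 2)     ∎
  where open ≤-Reasoning
2*k≤k^[k+2] 1 (s≤s ())

proposition3p5 : (L : Vocabulary) (k : ℕ) → 2 ≤ k →
    (n : ℕ) (M : Structure L n) → SptLe L M k → SptStarLe L M (k ^ (k + 2))
proposition3p5 L k 2≤k n M spt S movable =
  ≤-trans (spt*≤2*spt {L} M spt S movable) (2*k≤k^[k+2] k 2≤k)
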